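{- Let $\Gamma$ be a minimal prime graph and let $K\subseteq V(\Gamma)$ be such that (i) $K$ is a maximal clique in $\Gamma$, and (ii) there exists a proper 3-coloring of $\overline{\Gamma}$ in which the vertices of $K$ are colored using at most two colors. Then $V(\Gamma)\setminus K$ is a generation site; that is, the graph obtained from $\Gamma$ by adding a new vertex $w$ adjacent exactly to the vertices of $V(\Gamma)\setminus K$ is a minimal prime graph.
   Context: All graphs are finite, simple and undirected; $\overline{\Gamma}$ is the complement of $\Gamma$. A clique is a set of pairwise adjacent vertices; it is maximal if it is not properly contained in another clique. A minimal prime graph is a connected graph $\Gamma$ on two or more vertices such that (1) $\overline{\Gamma}$ is triangle-free, (2) $\overline{\Gamma}$ is 3-colorable, and (3) for every edge $e$ of $\Gamma$, the complement of the graph obtained from $\Gamma$ by deleting $e$ is not both triangle-free and 3-colorable. For a minimal prime graph $\Gamma$, a subset $U\subseteq V(\Gamma)$ is a generation site if the graph obtained from $\Gamma$ by adding a new vertex $w$ and edges $\{w,u\}$ for all $u\in U$ is a minimal prime graph. -}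

module Defs where

open import Data.Nat using (ℕ; suc; _≤_)
open import Data.Fin using (Fin; zero; suc; _≟_)
open import Data.Fin.Subset using (Subset; _∈_; _⊆_)
open import Data.Vec using (lookup)
open import Data.Bool using (Bool; true; false; not; _∧_; _∨_)
open import Data.Product using (Σ; ∃; _×_)
open import Data.Sum using (_⊎_)
open import Relation.Nullary using (¬_)
open import Relation.Nullary.Decidable using (⌊_⌋)
open import Relation.Binary.PropositionalEquality using (_≡_; _≢_)

Adj : ℕ → Set
Adj n = Fin n → Fin n → Bool

IsSimple : ∀ {n} → Adj n → Set
IsSimple {n} G = (∀ (i j : Fin n) → G i j ≡ G j i) × (∀ (i : Fin n) → G i i ≡ false)

compl : ∀ {n} → Adj n → Adj n
compl G i j = not (G i j) ∧ not ⌊ i ≟ j ⌋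

deleteEdge : ∀ {n} → Adj n → Fin n → Fin n → Adj n
deleteEdge G a b i j =
  G i j ∧ not ((⌊ i ≟ a ⌋ ∧ ⌊ j ≟ b ⌋) ∨ (⌊ i ≟ b ⌋ ∧ ⌊ j ≟ a ⌋))

-- Add a new vertex w (= zero) adjacent exactly to the vertices of U;
-- old vertex v becomes suc v.
addVertex : ∀ {n} → Adj n → Subset n → Adj (suc n)
addVertex G U zero    zero    = false
addVertex G U zero    (suc j) = lookup U j
addVertex G U (suc i) zero    = lookup U i
addVertex G U (suc i) (suc j) = G i j

data Walk {n} (G : Adj n) : Fin n → Fin n → Set where
  here : ∀ {i} → Walk G i i
  step : ∀ {i k j} → G i k ≡ true → Walk G k j → Walk G i j

Connected : ∀ {n} → Adj n → Set
Connected {n} G = ∀ (i j : Fin n) → Walk G i j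

TriangleFree : ∀ {n} → Adj n → Set
TriangleFree {n} G =
  ¬ (Σ (Fin n) λ a → Σ (Fin n) λ b → Σ (Fin n) λ c →
       G a b ≡ true × G b c ≡ true × G a c ≡ true)

ProperColoring : ∀ {n} (k : ℕ) → Adj n → (Fin n → Fin k) → Set
ProperColoring {n} k G col = ∀ (i j : Fin n) → G i j ≡ true → col i ≢ col j

ThreeColorable : ∀ {n} → Adj n → Set
ThreeColorable {n} G = Σ (Fin n → Fin 3) λ col → ProperColoring 3 G col

MinimalPrime : ∀ {n} → Adj n → Set
MinimalPrime {n} G =
  IsSimple G × Connected G × 2 ≤ n ×
  TriangleFree (compl G) × ThreeColorable (compl G) ×
  (∀ (a b : Fin n) → G a b ≡ true →
     ¬ (TriangleFree (compl (deleteEdge G a b)) ×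
        ThreeColorable (compl (deleteEdge G a b))))

GenerationSite : ∀ {n} → Adj n → Subset n → Set
GenerationSite G U = MinimalPrime (addVertex G U)

IsClique : ∀ {n} → Adj n → Subset n → Set
IsClique {n} G K = ∀ (i j : Fin n) → i ∈ K → j ∈ K → i ≢ j → G i j ≡ true

IsMaximalClique : ∀ {n} → Adj n → Subset n → Set
IsMaximalClique {n} G K =
  IsClique G K × (∀ (K' : Subset n) → IsClique G K' → K ⊆ K' → K' ⊆ K)

KTwoColoredIn3Coloring : ∀ {n} → Adj n → Subset n → Set
KTwoColoredIn3Coloring {n} G K =
  Σ (Fin n → Fin 3) λ col → ProperColoring 3 (compl G) col ×
    Σ (Fin 3) λ c₁ → Σ (Fin 3) λ c₂ →
      ∀ (v : Fin n) → v ∈ K → (col v ≡ c₁ ⊎ col v ≡ c₂)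

-- The new vertex w is a complement-neighbour exactly of the vertices of K.  Since K is a
-- clique of Γ, no triangle of the complement passes through w, and w can take a colour
-- missing on K.  Deleting an old edge of the new graph deletes an edge of Γ, so
-- minimality of Γ is inherited by restriction; deleting an edge wv with v ∉ K creates a
-- complement triangle w v k, where k ∈ K is a non-neighbour of v, which exists by
-- maximality of K.  Finally w has a neighbour because Γ is not complete: deleting an
-- edge of a complete graph leaves a single complement edge.
module Submission where

open import Defs
open import Data.Nat using (ℕ; zero; suc; _≤_; s≤s; z≤n)
open import Data.Nat.Properties using (m≤n⇒m≤1+n)
open import Data.Fin using (Fin; zero; suc; inject₁; _≟_)
open import Data.Fin.Properties using (any?; ¬∀⟶∃¬; inject₁-injective; suc-injective)
open import Data.Fin.Subset using (Subset; ∁; _∈_; _∉_; _∪_; ⁅_⁆)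
open import Data.Fin.Subset.Properties
  using (_∈?_; x∈⁅x⁆; x∈⁅y⁆⇒x≡y; p⊆p∪q; x∈p∪q⁺; x∈p∪q⁻; x∈p⇒x∉∁p; x∈∁p⇒x∉p; x∉∁p⇒x∈p; x∉p⇒x∈∁p)
open import Data.Vec.Properties using (lookup⇒[]=; []=⇒lookup)
open import Data.Vec.Functional using (_∷_)
open import Data.Bool using (true; false; not; _∧_; T)
import Data.Bool.Properties as Bool
open import Data.Product using (∃; _×_; _,_; proj₁; proj₂)
import Data.Product as Product
open import Data.Sum using (_⊎_; inj₁; inj₂)
import Data.Sum as Sum
open import Data.Empty using (⊥)
open import Function using (_∘_; id)
open import Function.Bundles using (Equivalence)
open import Relation.Nullary using (¬_; yes; no; contradiction)
open import Relation.Nullary.Decidable using (⌊_⌋; ⌊⌋-map′; toWitness; _×-dec_)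
open import Relation.Binary.PropositionalEquality
  using (_≡_; _≢_; refl; sym; trans; cong; ≡-≟-identity; ≢-≟-identity)

private
  variable
    m n k : ℕ

Admissible : Adj n → Set
Admissible G = TriangleFree (compl G) × ThreeColorable (compl G)

EdgeCritical : Adj n → Set
EdgeCritical {n} G = ∀ (a b : Fin n) → G a b ≡ true → ¬ Admissible (deleteEdge G a b)

Complete : Adj n → Set
Complete {n} G = ∀ (x y : Fin n) → x ≢ y → G x y ≡ true

IsHomomorphism : Adj m → Adj n → (Fin m → Fin n) → Set
IsHomomorphism {m} G H f = ∀ (x y : Fin m) → G x y ≡ true → H (f x) (f y) ≡ true

⌊suc≟suc⌋ : {x y : Fin n} → ⌊ suc x ≟ suc y ⌋ ≡ ⌊ x ≟ y ⌋
⌊suc≟suc⌋ {x = x} {y} = ⌊⌋-map′ (cong suc) suc-injective (x ≟ y)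

compl-edge⇒nonEdge : (G : Adj n) {i j : Fin n} → compl G i j ≡ true → G i j ≡ false × i ≢ j
compl-edge⇒nonEdge G {i} {j} e with G i j | i ≟ j
... | false | no i≢j = refl , i≢j

nonEdge⇒compl-edge : (G : Adj n) {i j : Fin n} → G i j ≡ false → i ≢ j → compl G i j ≡ true
nonEdge⇒compl-edge G {i} {j} nonEdge i≢j rewrite nonEdge | ≢-≟-identity _≟_ i≢j = refl

clique⇒compl-independent : {G : Adj n} {K : Subset n} {i j : Fin n} →
  IsClique G K → i ∈ K → j ∈ K → compl G i j ≢ true
clique⇒compl-independent {G = G} {i = i} {j} clique i∈K j∈K e
  with nonEdge , i≢j ← compl-edge⇒nonEdge G e
  with () ← trans (sym (clique i j i∈K j∈K i≢j)) nonEdge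

compl-deleteEdge⁺ : (G : Adj n) {a b x y : Fin n} →
  compl G x y ≡ true → compl (deleteEdge G a b) x y ≡ true
compl-deleteEdge⁺ G e with nonEdge , x≢y ← compl-edge⇒nonEdge G e =
  nonEdge⇒compl-edge (deleteEdge G _ _) (cong (_∧ _) nonEdge) x≢y

compl-deleteEdge-deleted : (G : Adj n) {a b : Fin n} → a ≢ b → compl (deleteEdge G a b) a b ≡ true
compl-deleteEdge-deleted G {a} {b} a≢b = nonEdge⇒compl-edge (deleteEdge G a b) deleted a≢b
  where
  deleted : deleteEdge G a b a b ≡ false
  deleted rewrite ≡-≟-identity _≟_ {a} refl | ≡-≟-identity _≟_ {b} refl = Bool.∧-zeroʳ (G a b)

commonComplNeighbour⇒¬triangleFree : (G : Adj n) {a b c : Fin n} → a ≢ b →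
  compl G a c ≡ true → compl G b c ≡ true → ¬ TriangleFree (compl (deleteEdge G a b))
commonComplNeighbour⇒¬triangleFree G {a} {b} {c} a≢b ac bc triangleFree =
  triangleFree (a , b , c , compl-deleteEdge-deleted G a≢b ,
                compl-deleteEdge⁺ G bc , compl-deleteEdge⁺ G ac)

triangleFree-pullback : {G : Adj m} {H : Adj n} (f : Fin m → Fin n) →
  IsHomomorphism G H f → TriangleFree H → TriangleFree G
triangleFree-pullback f hom triangleFree (a , b , c , ab , bc , ac) =
  triangleFree (f a , f b , f c , hom a b ab , hom b c bc , hom a c ac)

properColoring-pullback : {G : Adj m} {H : Adj n} (f : Fin m → Fin n) {col : Fin n → Fin k} →
  IsHomomorphism G H f → ProperColoring k H col → ProperColoring k G (col ∘ f)
properColoring-pullback f hom proper x y xy = proper (f x) (f y) (hom x y xy)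

admissible-pullback : {G : Adj m} {H : Adj n} (f : Fin m → Fin n) →
  IsHomomorphism (compl G) (compl H) f → Admissible H → Admissible G
admissible-pullback f hom (triangleFree , col , proper) =
  triangleFree-pullback f hom triangleFree , col ∘ f , properColoring-pullback f hom proper

walk-map : {G : Adj m} {H : Adj n} (f : Fin m → Fin n) → IsHomomorphism G H f →
  {i j : Fin m} → Walk G i j → Walk H (f i) (f j)
walk-map f hom here              = here
walk-map f hom (step {i} {k} e w) = step (hom i k e) (walk-map f hom w)

walk-++ : {G : Adj n} {i j l : Fin n} → Walk G i j → Walk G j l → Walk G i l
walk-++ here       w′ = w′
walk-++ (step e w) w′ = step e (walk-++ w w′)

properColoring-inject₁ : {G : Adj n} {col : Fin n → Fin k} →
  ProperColoring k G col → ProperColoring (suc k) G (inject₁ ∘ col)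
properColoring-inject₁ proper x y xy = proper x y xy ∘ inject₁-injective

Fin2-¬distinct₃ : {x y z : Fin 2} → x ≢ y → y ≢ z → x ≢ z → ⊥
Fin2-¬distinct₃ {zero}     {zero}                 x≢y _   _   = x≢y refl
Fin2-¬distinct₃ {suc zero} {suc zero}             x≢y _   _   = x≢y refl
Fin2-¬distinct₃ {zero}     {suc zero} {zero}      _   _   x≢z = x≢z refl
Fin2-¬distinct₃ {zero}     {suc zero} {suc zero}  _   y≢z _   = y≢z refl
Fin2-¬distinct₃ {suc zero} {zero}     {zero}      _   y≢z _   = y≢z refl
Fin2-¬distinct₃ {suc zero} {zero}     {suc zero}  _   _   x≢z = x≢z refl

twoColorable⇒triangleFree : {G : Adj n} {col : Fin n → Fin 2} →
  ProperColoring 2 G col → TriangleFree G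
twoColorable⇒triangleFree proper (a , b , c , ab , bc , ac) =
  Fin2-¬distinct₃ (proper a b ab) (proper b c bc) (proper a c ac)

avoid-two : (c₁ c₂ : Fin (suc (suc (suc n)))) → ∃ λ c → c ≢ c₁ × c ≢ c₂
avoid-two zero             zero             = suc zero , (λ ()) , (λ ())
avoid-two zero             (suc zero)       = suc (suc zero) , (λ ()) , (λ ())
avoid-two zero             (suc (suc _))    = suc zero , (λ ()) , (λ ())
avoid-two (suc zero)       zero             = suc (suc zero) , (λ ()) , (λ ())
avoid-two (suc (suc _))    zero             = suc zero , (λ ()) , (λ ())
avoid-two (suc _)          (suc _)          = zero , (λ ()) , (λ ())

compl-deleteEdge-complete : {G : Adj n} {a b x y : Fin n} → Complete G →
  compl (deleteEdge G a b) x y ≡ true → (x ≡ a × y ≡ b) ⊎ (x ≡ b × y ≡ a)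
compl-deleteEdge-complete {G = G} {a} {b} {x} {y} complete e
  with nonEdge , x≢y ← compl-edge⇒nonEdge (deleteEdge G a b) e
  rewrite complete x y x≢y =
  Sum.map witnesses witnesses
    (Equivalence.to Bool.T-∨ (Equivalence.from Bool.T-≡ (Bool.not-injective nonEdge)))
  where
  witnesses : {u v p q : Fin n} → T (⌊ u ≟ p ⌋ ∧ ⌊ v ≟ q ⌋) → u ≡ p × v ≡ q
  witnesses {u = u} {v} {p} {q} t =
    Product.map (toWitness {a? = u ≟ p}) (toWitness {a? = v ≟ q}) (Equivalence.to Bool.T-∧ t)

complete⇒¬edgeCritical : {G : Adj n} → 2 ≤ n → Complete G → ¬ EdgeCritical G
complete⇒¬edgeCritical {suc (suc _)} {G} (s≤s (s≤s z≤n)) complete critical =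
  critical zero (suc zero) (complete zero (suc zero) (λ ()))
    (twoColorable⇒triangleFree proper , inject₁ ∘ side , properColoring-inject₁ proper)
  where
  side : Fin (suc (suc _)) → Fin 2
  side zero    = zero
  side (suc _) = suc zero
  proper : ProperColoring 2 (compl (deleteEdge G zero (suc zero))) side
  proper x y e with compl-deleteEdge-complete complete e
  ... | inj₁ (refl , refl) = λ ()
  ... | inj₂ (refl , refl) = λ ()

maximalClique-nonNeighbour : {G : Adj n} {K : Subset n} {j : Fin n} →
  (∀ x y → G x y ≡ G y x) → IsMaximalClique G K → j ∉ K → ∃ λ k → k ∈ K × G j k ≡ false
maximalClique-nonNeighbour {G = G} {K} {j} symmetric (clique , maximal) j∉K
  with any? (λ k → k ∈? K ×-dec G j k Bool.≟ false)
... | yes found = found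
... | no none =
  contradiction (maximal (K ∪ ⁅ j ⁆) extended (p⊆p∪q ⁅ j ⁆) (x∈p∪q⁺ (inj₂ (x∈⁅x⁆ j)))) j∉K
  where
  adjacent : ∀ x → x ∈ K → G j x ≡ true
  adjacent x x∈K = Bool.¬-not (λ nonEdge → none (x , x∈K , nonEdge))
  extended : IsClique G (K ∪ ⁅ j ⁆)
  extended x y x∈ y∈ x≢y with x∈p∪q⁻ K ⁅ j ⁆ x∈ | x∈p∪q⁻ K ⁅ j ⁆ y∈
  ... | inj₁ x∈K | inj₁ y∈K = clique x y x∈K y∈K x≢y
  ... | inj₁ x∈K | inj₂ y∈⁅j⁆ rewrite x∈⁅y⁆⇒x≡y j y∈⁅j⁆ = trans (symmetric x j) (adjacent x x∈K)
  ... | inj₂ x∈⁅j⁆ | inj₁ y∈K rewrite x∈⁅y⁆⇒x≡y j x∈⁅j⁆ = adjacent y y∈K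
  ... | inj₂ x∈⁅j⁆ | inj₂ y∈⁅j⁆ =
    contradiction (trans (x∈⁅y⁆⇒x≡y j x∈⁅j⁆) (sym (x∈⁅y⁆⇒x≡y j y∈⁅j⁆))) x≢y

module _ (G : Adj n) (U : Subset n) where

  -- compl H (suc j) zero and compl H zero (suc j) are definitionally equal, so the
  -- lemmas about the new vertex below serve both orientations of an edge.
  private
    H : Adj (suc n)
    H = addVertex G U

  compl-addVertex-old : (x y : Fin n) → compl H (suc x) (suc y) ≡ compl G x y
  compl-addVertex-old x y = cong (λ b → not (G x y) ∧ not b) ⌊suc≟suc⌋

  compl-deleteEdge-addVertex-old : (a b x y : Fin n) →
    compl (deleteEdge H (suc a) (suc b)) (suc x) (suc y) ≡ compl (deleteEdge G a b) x y
  compl-deleteEdge-addVertex-old a b x y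
    rewrite ⌊suc≟suc⌋ {x = x} {a} | ⌊suc≟suc⌋ {x = y} {b} | ⌊suc≟suc⌋ {x = x} {b}
          | ⌊suc≟suc⌋ {x = y} {a} | ⌊suc≟suc⌋ {x = x} {y} = refl

  compl-addVertex-new⇒∉ : {j : Fin n} → compl H zero (suc j) ≡ true → j ∉ U
  compl-addVertex-new⇒∉ {j} e j∈U
    with () ← trans (sym ([]=⇒lookup j∈U)) (proj₁ (compl-edge⇒nonEdge H {zero} {suc j} e))

  ∉⇒compl-addVertex-new : {j : Fin n} → j ∉ U → compl H zero (suc j) ≡ true
  ∉⇒compl-addVertex-new {j} j∉U =
    nonEdge⇒compl-edge H {zero} {suc j} (Bool.¬-not (j∉U ∘ lookup⇒[]= j U)) (λ ())

  addVertex-isSimple : IsSimple G → IsSimple H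
  addVertex-isSimple (symmetric , loopless) = symmetric′ , loopless′
    where
    symmetric′ : ∀ x y → H x y ≡ H y x
    symmetric′ zero    zero    = refl
    symmetric′ zero    (suc _) = refl
    symmetric′ (suc _) zero    = refl
    symmetric′ (suc x) (suc y) = symmetric x y
    loopless′ : ∀ x → H x x ≡ false
    loopless′ zero    = refl
    loopless′ (suc x) = loopless x

  addVertex-connected : Connected G → {u : Fin n} → u ∈ U → Connected H
  addVertex-connected connected {u} u∈U = connected′
    where
    w-u : H zero (suc u) ≡ true
    w-u = []=⇒lookup u∈U
    old : {i j : Fin n} → Walk G i j → Walk H (suc i) (suc j)
    old = walk-map suc (λ _ _ → id)
    connected′ : Connected H
    connected′ zero    zero    = here
    connected′ zero    (suc j) = step w-u (old (connected u j))
    connected′ (suc i) zero    = walk-++ (old (connected i u)) (step w-u here)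
    connected′ (suc i) (suc j) = old (connected i j)

  addVertex-complTriangleFree : TriangleFree (compl G) →
    (∀ {i j} → i ∉ U → j ∉ U → compl G i j ≢ true) → TriangleFree (compl H)
  addVertex-complTriangleFree triangleFree independent = triangleFree′
    where
    old : {i j : Fin n} → compl H (suc i) (suc j) ≡ true → compl G i j ≡ true
    old {i} {j} = trans (sym (compl-addVertex-old i j))
    independent′ : {i j : Fin n} → compl H zero (suc i) ≡ true → compl H zero (suc j) ≡ true →
      compl G i j ≢ true
    independent′ wi wj = independent (compl-addVertex-new⇒∉ wi) (compl-addVertex-new⇒∉ wj)
    triangleFree′ : TriangleFree (compl H)
    triangleFree′ (zero  , zero  , _     , () , _)
    triangleFree′ (zero  , suc _ , zero  , _  , _  , ())
    triangleFree′ (suc _ , zero  , zero  , _  , () , _)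
    triangleFree′ (zero  , suc i , suc j , wi , ij , wj) = independent′ wi wj (old ij)
    triangleFree′ (suc i , zero  , suc j , iw , wj , ij) = independent′ iw wj (old ij)
    triangleFree′ (suc i , suc j , zero  , ij , jw , iw) = independent′ iw jw (old ij)
    triangleFree′ (suc i , suc j , suc k , ij , jk , ik) =
      triangleFree (i , j , k , old ij , old jk , old ik)

  addVertex-complProperColoring : {col : Fin n → Fin k} {c : Fin k} →
    ProperColoring k (compl G) col → (∀ {j} → j ∉ U → col j ≢ c) →
    ProperColoring k (compl H) (c ∷ col)
  addVertex-complProperColoring proper avoids = λ where
    zero    zero    ()
    zero    (suc j) wj → avoids (compl-addVertex-new⇒∉ wj) ∘ sym
    (suc i) zero    iw → avoids (compl-addVertex-new⇒∉ iw)
    (suc i) (suc j) ij → proper i j (trans (sym (compl-addVertex-old i j)) ij)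

  addVertex-edgeCritical : EdgeCritical G →
    (∀ {j} → j ∈ U → ∃ λ k → k ∉ U × compl G j k ≡ true) → EdgeCritical H
  addVertex-edgeCritical critical separated = λ where
    zero    zero    ()
    zero    (suc j) wj (triangleFree , _) → let k , k∉U , jk = separated (lookup⇒[]= j U wj) in
      commonComplNeighbour⇒¬triangleFree H {c = suc k} (λ ())
        (∉⇒compl-addVertex-new k∉U) (trans (compl-addVertex-old j k) jk) triangleFree
    (suc j) zero    jw (triangleFree , _) → let k , k∉U , jk = separated (lookup⇒[]= j U jw) in
      commonComplNeighbour⇒¬triangleFree H {c = suc k} (λ ())
        (trans (compl-addVertex-old j k) jk) (∉⇒compl-addVertex-new k∉U) triangleFree
    (suc a) (suc b) ab admissible →
      critical a b ab (admissible-pullback suc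
        (λ x y → trans (compl-deleteEdge-addVertex-old a b x y)) admissible)

mainTheorem19 : ∀ (n : ℕ) (G : Adj n) (K : Subset n) →
    MinimalPrime G → IsMaximalClique G K → KTwoColoredIn3Coloring G K →
    GenerationSite G (∁ K)
mainTheorem19 n G K (simple@(symmetric , _) , connected , 2≤n , triangleFree , _ , critical)
  maximal@(clique , _) (col , proper , c₁ , c₂ , twoColours) =
  addVertex-isSimple G (∁ K) simple ,
  addVertex-connected G (∁ K) connected (x∉p⇒x∈∁p (proj₂ outside)) ,
  m≤n⇒m≤1+n 2≤n ,
  addVertex-complTriangleFree G (∁ K) triangleFree
    (λ i∉∁K j∉∁K → clique⇒compl-independent clique (x∉∁p⇒x∈p i∉∁K) (x∉∁p⇒x∈p j∉∁K)) ,
  (c ∷ col , addVertex-complProperColoring G (∁ K) proper avoids) ,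
  addVertex-edgeCritical G (∁ K) critical separated
  where
  outside : ∃ λ u → u ∉ K
  outside = ¬∀⟶∃¬ n (_∈ K) (_∈? K) λ all∈K →
    complete⇒¬edgeCritical 2≤n (λ x y → clique x y (all∈K x) (all∈K y)) critical
  c : Fin 3
  c = proj₁ (avoid-two c₁ c₂)
  avoids : ∀ {j} → j ∉ ∁ K → col j ≢ c
  avoids {j} j∉∁K with avoid-two c₁ c₂ | twoColours j (x∉∁p⇒x∈p j∉∁K)
  ... | _ , c≢c₁ , _ | inj₁ refl = c≢c₁ ∘ sym
  ... | _ , _ , c≢c₂ | inj₂ refl = c≢c₂ ∘ sym
  separated : ∀ {j} → j ∈ ∁ K → ∃ λ k → k ∉ ∁ K × compl G j k ≡ true
  separated j∈∁K
    with k , k∈K , nonEdge ← maximalClique-nonNeighbour symmetric maximal (x∈∁p⇒x∉p j∈∁K) =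
    k , x∈p⇒x∉∁p k∈K , nonEdge⇒compl-edge G nonEdge λ { refl → x∈∁p⇒x∉p j∈∁K k∈K }
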